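{- Let $G$ be a finite simple undirected graph and $x\in V_G$. Then \[\tfrac12\operatorname{nlcw}(G)\le\operatorname{nlcw}(LC(G,x))\le 2\operatorname{nlcw}(G)\quad\text{and}\quad \tfrac13\operatorname{cw}(G)\le\operatorname{cw}(LC(G,x))\le 3\operatorname{cw}(G).\]
   Context: Local complementation: $LC(G,x)$ has vertex set $V_G$ and is obtained from $G$ by replacing the subgraph induced by $N_G(x)$ (the neighbors of $x$) by its edge complement: for distinct $y,z\in N_G(x)$, $\{y,z\}$ is an edge of $LC(G,x)$ iff it is not an edge of $G$; all other adjacencies are unchanged. Clique-width: for a positive integer $k$, $\mathrm{CW}_k$ is the smallest class of graphs whose vertices carry labels from $\{1,\dots,k\}$ that contains every single-vertex graph with any label and is closed under: disjoint union; relabeling $\rho_{a\to b}$ for $a\neq b$; and $\eta_{a,b}$ for $a\neq b$ (add all edges between vertices labeled $a$ and vertices labeled $b$). $\operatorname{cw}(G)$ is the least $k$ such that some labeling of $G$ lies in $\mathrm{CW}_k$. NLC-width: $\mathrm{NLC}_k$ is the smallest class of labeled graphs (labels in $\{1,\dots,k\}$) containing every single-vertex graph with any label and closed under: $G\times_S J$ for $S\subseteq\{1,\dots,k\}^2$ (disjoint union of vertex-disjoint $G$ and $J$ plus all edges $\{u,v\}$, $u\in V_G$, $v\in V_J$, $(\mathrm{lab}(u),\mathrm{lab}(v))\in S$); and $\circ_R$ for $R:\{1,\dots,k\}\to\{1,\dots,k\}$. $\operatorname{nlcw}(G)$ is the least $k$ such that some labeling of $G$ lies in $\mathrm{NLC}_k$.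 -}

module Defs where

open import Data.Nat using (ℕ; _+_)
open import Data.Fin using (Fin; splitAt; _≟_)
open import Data.Bool using (Bool; true; false; _∧_; _∨_; not; if_then_else_)
open import Data.Sum using (inj₁; inj₂)
open import Data.Product using (Σ; _×_)
open import Relation.Nullary using (¬_)
open import Relation.Nullary.Decidable using (⌊_⌋)
open import Relation.Binary.PropositionalEquality using (_≡_; _≢_)
open import Function.Bundles using (_↔_; Inverse)

Adj : ℕ → Set
Adj n = Fin n → Fin n → Bool

record IsSimple {n : ℕ} (A : Adj n) : Set where
  field
    symm   : ∀ u v → A u v ≡ A v u
    irrefl : ∀ u → A u u ≡ false

_==_ : ∀ {k} → Fin k → Fin k → Bool
a == b = ⌊ a ≟ b ⌋

LC : ∀ {n} → Adj n → Fin n → Adj n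
LC A x y z =
  if A x y ∧ A x z ∧ not (y == z) then not (A y z) else A y z

union : ∀ {m n} → Adj m → Adj n → (Fin m → Fin n → Bool) → Adj (m + n)
union {m} A B cross i j with splitAt m i | splitAt m j
... | inj₁ u | inj₁ v = A u v
... | inj₂ u | inj₂ v = B u v
... | inj₁ u | inj₂ v = cross u v
... | inj₂ u | inj₁ v = cross v u

joinLab : ∀ {m n k} → (Fin m → Fin k) → (Fin n → Fin k) → Fin (m + n) → Fin k
joinLab {m} l₁ l₂ i with splitAt m i
... | inj₁ u = l₁ u
... | inj₂ v = l₂ v

data CWExpr (k : ℕ) : ℕ → Set where
  vtx : Fin k → CWExpr k 1
  _⊕_ : ∀ {m n} → CWExpr k m → CWExpr k n → CWExpr k (m + n)
  ρ   : ∀ {n} (a b : Fin k) → a ≢ b → CWExpr k n → CWExpr k n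
  η   : ∀ {n} (a b : Fin k) → a ≢ b → CWExpr k n → CWExpr k n

cwLab : ∀ {k n} → CWExpr k n → Fin n → Fin k
cwLab (vtx a) _ = a
cwLab (e₁ ⊕ e₂) = joinLab (cwLab e₁) (cwLab e₂)
cwLab (ρ a b _ e) v = if cwLab e v == a then b else cwLab e v
cwLab (η a b _ e) = cwLab e

cwAdj : ∀ {k n} → CWExpr k n → Adj n
cwAdj (vtx a) _ _ = false
cwAdj (e₁ ⊕ e₂) = union (cwAdj e₁) (cwAdj e₂) (λ _ _ → false)
cwAdj (ρ a b _ e) = cwAdj e
cwAdj (η a b _ e) u v =
  cwAdj e u v
  ∨ ((cwLab e u == a) ∧ (cwLab e v == b))
  ∨ ((cwLab e u == b) ∧ (cwLab e v == a))

data NLCExpr (k : ℕ) : ℕ → Set where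
  vtx  : Fin k → NLCExpr k 1
  join : ∀ {m n} → (S : Fin k → Fin k → Bool) →
         NLCExpr k m → NLCExpr k n → NLCExpr k (m + n)
  relab : ∀ {n} → (R : Fin k → Fin k) → NLCExpr k n → NLCExpr k n

nlcLab : ∀ {k n} → NLCExpr k n → Fin n → Fin k
nlcLab (vtx a) _ = a
nlcLab (join S e₁ e₂) = joinLab (nlcLab e₁) (nlcLab e₂)
nlcLab (relab R e) v = R (nlcLab e v)

nlcAdj : ∀ {k n} → NLCExpr k n → Adj n
nlcAdj (vtx a) _ _ = false
nlcAdj (join S e₁ e₂) =
  union (nlcAdj e₁) (nlcAdj e₂) (λ u v → S (nlcLab e₁ u) (nlcLab e₂ v))
nlcAdj (relab R e) = nlcAdj e

IsoTo : ∀ {n m} → Adj n → Adj m → Set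
IsoTo {n} {m} A B =
  Σ (Fin n ↔ Fin m) λ f → ∀ u v → A u v ≡ B (Inverse.to f u) (Inverse.to f v)

InCW : ℕ → ∀ {n} → Adj n → Set
InCW k {n} A = Σ (CWExpr k n) λ e → IsoTo A (cwAdj e)

InNLC : ℕ → ∀ {n} → Adj n → Set
InNLC k {n} A = Σ (NLCExpr k n) λ e → IsoTo A (nlcAdj e)

IsCW : ∀ {n} → Adj n → ℕ → Set
IsCW A k = InCW k A × (∀ j → InCW j A → k Data.Nat.≤ j)

IsNLCW : ∀ {n} → Adj n → ℕ → Set
IsNLCW A k = InNLC k A × (∀ j → InNLC j A → k Data.Nat.≤ j)

{-# OPTIONS --safe #-}
module Submission where

-- Local complementation at x complements the subgraph induced by N(x), and LC (LC G x) x = G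
-- because x is not its own neighbour.  So it suffices that complementing the subgraph induced
-- by an arbitrary vertex set N at most doubles the NLC-width and at most triples the
-- clique-width.  An expression for G is translated label by label, a label a becoming a pair
-- (tag, a) whose tag records membership in N.  For NLC-width a join with S becomes the join
-- with S xor "both endpoints in N".  For clique-width an edge may be created by η long after
-- its endpoints were brought together by ⊕: the translated η creates no edge inside N, and
-- instead each ⊕ creates, between the N-vertices of its two operands (told apart by a third,
-- temporary tag), exactly the edges that the rest of the expression will not create.

open import Defs
open import Data.Nat using (ℕ; _≤_; _*_; _+_; suc)
open import Data.Fin using (Fin; zero; suc; splitAt; _↑ˡ_; _↑ʳ_; _≟_; combine; quotient; remainder)
open import Data.Fin.Properties
  using (splitAt⁻¹-↑ˡ; splitAt⁻¹-↑ʳ; splitAt-↑ˡ; splitAt-↑ʳ; remQuot-combine)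
open import Data.Bool using (Bool; true; false; _∧_; _∨_; not; _xor_; if_then_else_; T)
open import Data.Bool.Properties
  using (∧-comm; ∧-zeroʳ; ∧-identityʳ; ∨-assoc; ∨-comm; ∨-identityʳ; not-involutive; T-≡; T-∧; T-∨; ⇔→≡)
open import Data.Sum as Sum using (_⊎_; inj₁; inj₂)
open import Data.Product as Product using (_×_; _,_; proj₁; proj₂)
open import Data.List using (List; []; _∷_; allFin; cartesianProduct)
open import Data.Bool.ListAction using (any)
open import Data.List.Membership.Propositional using (_∈_; lose)
open import Data.List.Membership.Propositional.Properties using (∈-allFin; ∈-cartesianProduct⁺)
open import Data.List.Relation.Unary.Any using (here; there; satisfied)
open import Data.List.Relation.Unary.Any.Properties using (any⁺; any⁻)
open import Function using (_∘_; id)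
open import Function.Bundles using (_↔_; Inverse; Injection; mk⇔; module Equivalence)
open import Function.Properties.Inverse using (↔⇒↣)
open import Relation.Nullary using (Dec; yes; no; contradiction)
open import Relation.Nullary.Decidable using (dec-true; dec-false; isYes≗does; toWitness)
open import Relation.Binary.PropositionalEquality
open ≡-Reasoning

open Inverse using (to)
open Equivalence using () renaming (to to to⇔; from to from⇔)

==-refl : ∀ {k} (u : Fin k) → (u == u) ≡ true
==-refl u = trans (isYes≗does (u ≟ u)) (dec-true (u ≟ u) refl)

==-≢ : ∀ {k} {u v : Fin k} → u ≢ v → (u == v) ≡ false
==-≢ {u = u} {v} u≢v = trans (isYes≗does (u ≟ v)) (dec-false (u ≟ v) u≢v)

==-∧-==-≢ : ∀ {k} {a b : Fin k} → a ≢ b → ∀ c → ((c == a) ∧ (c == b)) ≡ false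
==-∧-==-≢ {a = a} a≢b c with c ≟ a
... | yes refl = ==-≢ a≢b
... | no _     = refl

data Split (m n : ℕ) : Fin (m + n) → Set where
  left  : (i : Fin m) → Split m n (i ↑ˡ n)
  right : (j : Fin n) → Split m n (m ↑ʳ j)

split : ∀ m {n} (u : Fin (m + n)) → Split m n u
split m {n} u with splitAt m u in eq
... | inj₁ i = subst (Split m n) (splitAt⁻¹-↑ˡ eq) (left i)
... | inj₂ j = subst (Split m n) (splitAt⁻¹-↑ʳ eq) (right j)

module _ {m n : ℕ} {A : Adj m} {B : Adj n} {c : Fin m → Fin n → Bool} where

  union-ˡˡ : ∀ i j → union A B c (i ↑ˡ n) (j ↑ˡ n) ≡ A i j
  union-ˡˡ i j rewrite splitAt-↑ˡ m i n | splitAt-↑ˡ m j n = refl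

  union-ʳʳ : ∀ i j → union A B c (m ↑ʳ i) (m ↑ʳ j) ≡ B i j
  union-ʳʳ i j rewrite splitAt-↑ʳ m n i | splitAt-↑ʳ m n j = refl

  union-ˡʳ : ∀ i j → union A B c (i ↑ˡ n) (m ↑ʳ j) ≡ c i j
  union-ˡʳ i j rewrite splitAt-↑ˡ m i n | splitAt-↑ʳ m n j = refl

  union-ʳˡ : ∀ i j → union A B c (m ↑ʳ j) (i ↑ˡ n) ≡ c i j
  union-ʳˡ i j rewrite splitAt-↑ˡ m i n | splitAt-↑ʳ m n j = refl

module _ {m n k : ℕ} {l₁ : Fin m → Fin k} {l₂ : Fin n → Fin k} where

  joinLab-ˡ : ∀ i → joinLab l₁ l₂ (i ↑ˡ n) ≡ l₁ i
  joinLab-ˡ i rewrite splitAt-↑ˡ m i n = refl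

  joinLab-ʳ : ∀ j → joinLab l₁ l₂ (m ↑ʳ j) ≡ l₂ j
  joinLab-ʳ j rewrite splitAt-↑ʳ m n j = refl

union-unique : ∀ {m n} {G : Adj (m + n)} {A : Adj m} {B : Adj n} {c : Fin m → Fin n → Bool} →
  (∀ i j → G (i ↑ˡ n) (j ↑ˡ n) ≡ A i j) → (∀ i j → G (m ↑ʳ i) (m ↑ʳ j) ≡ B i j) →
  (∀ i j → G (i ↑ˡ n) (m ↑ʳ j) ≡ c i j) → (∀ i j → G (m ↑ʳ j) (i ↑ˡ n) ≡ c i j) →
  ∀ u v → G u v ≡ union A B c u v
union-unique {m} G-ˡˡ G-ʳʳ G-ˡʳ G-ʳˡ u v with split m u | split m v
... | left i  | left j  = trans (G-ˡˡ i j) (sym (union-ˡˡ {m} i j))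
... | right i | right j = trans (G-ʳʳ i j) (sym (union-ʳʳ {m} i j))
... | left i  | right j = trans (G-ˡʳ i j) (sym (union-ˡʳ {m} i j))
... | right j | left i  = trans (G-ʳˡ i j) (sym (union-ʳˡ {m} i j))

Irreflexive : ∀ {n} → Adj n → Set
Irreflexive A = ∀ u → A u u ≡ false

SameEdges : ∀ {n} → Adj n → Adj n → Set
SameEdges A B = ∀ {u v} → u ≢ v → A u v ≡ B u v

union-irreflexive : ∀ {m n} {A : Adj m} {B : Adj n} {c : Fin m → Fin n → Bool} →
  Irreflexive A → Irreflexive B → Irreflexive (union A B c)
union-irreflexive {m} A-irr B-irr u with split m u
... | left i  = trans (union-ˡˡ {m} i i) (A-irr i)
... | right j = trans (union-ʳʳ {m} j j) (B-irr j)

union-cong : ∀ {m n} {A A′ : Adj m} {B B′ : Adj n} {c c′ : Fin m → Fin n → Bool} →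
  SameEdges A A′ → SameEdges B B′ → (∀ i j → c i j ≡ c′ i j) →
  SameEdges (union A B c) (union A′ B′ c′)
union-cong {m} {n} A≐A′ B≐B′ c≗c′ {u} {v} u≢v with split m u | split m v
... | left i  | left j  = trans (union-ˡˡ {m} i j)
  (trans (A≐A′ (u≢v ∘ cong (_↑ˡ n))) (sym (union-ˡˡ {m} i j)))
... | right i | right j = trans (union-ʳʳ {m} i j)
  (trans (B≐B′ (u≢v ∘ cong (m ↑ʳ_))) (sym (union-ʳʳ {m} i j)))
... | left i  | right j = trans (union-ˡʳ {m} i j) (trans (c≗c′ i j) (sym (union-ˡʳ {m} i j)))
... | right j | left i  = trans (union-ʳˡ {m} i j) (trans (c≗c′ i j) (sym (union-ʳˡ {m} i j)))

complementOn : ∀ {n} → (Fin n → Bool) → Adj n → Adj n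
complementOn N A u v = (N u ∧ N v) xor A u v

complementOn-union : ∀ {m n} (N : Fin (m + n) → Bool) {A : Adj m} {B : Adj n} {c : Fin m → Fin n → Bool} →
  ∀ u v → complementOn N (union A B c) u v ≡
    union (complementOn (N ∘ (_↑ˡ n)) A) (complementOn (N ∘ (m ↑ʳ_)) B)
          (λ i j → (N (i ↑ˡ n) ∧ N (m ↑ʳ j)) xor c i j) u v
complementOn-union {m} {n} N = union-unique
  (λ i j → cong (N (i ↑ˡ n) ∧ N (j ↑ˡ n) xor_) (union-ˡˡ {m} i j))
  (λ i j → cong (N (m ↑ʳ i) ∧ N (m ↑ʳ j) xor_) (union-ʳʳ {m} i j))
  (λ i j → cong (N (i ↑ˡ n) ∧ N (m ↑ʳ j) xor_) (union-ˡʳ {m} i j))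
  (λ i j → cong₂ _xor_ (∧-comm (N (m ↑ʳ j)) (N (i ↑ˡ n))) (union-ʳˡ {m} i j))

LC-diagonal : ∀ {n} (A : Adj n) x u → LC A x u u ≡ A u u
LC-diagonal A x u rewrite ==-refl u | ∧-zeroʳ (A x u) | ∧-zeroʳ (A x u) = refl

LC-sameEdges : ∀ {n} (A : Adj n) x → SameEdges (LC A x) (complementOn (A x) A)
LC-sameEdges A x {u} {v} u≢v rewrite ==-≢ u≢v | ∧-identityʳ (A x v) with A x u ∧ A x v
... | true  = refl
... | false = refl

LC-involutive : ∀ {n} (A : Adj n) x → A x x ≡ false → ∀ u v → LC (LC A x) x u v ≡ A u v
LC-involutive A x Axx≡false u v rewrite Axx≡false with A x u ∧ A x v ∧ not (u == v)
... | true  = not-involutive (A u v)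
... | false = refl

IsoTo-respˡ : ∀ {n m} {A A′ : Adj n} {B : Adj m} →
  (∀ u v → A u v ≡ A′ u v) → IsoTo A B → IsoTo A′ B
IsoTo-respˡ A≡A′ (f , A≅B) = f , λ u v → trans (sym (A≡A′ u v)) (A≅B u v)

InNLC-resp : ∀ {k n} {A A′ : Adj n} → (∀ u v → A u v ≡ A′ u v) → InNLC k A → InNLC k A′
InNLC-resp A≡A′ (e , A≅e) = e , IsoTo-respˡ {B = nlcAdj e} A≡A′ A≅e

InCW-resp : ∀ {k n} {A A′ : Adj n} → (∀ u v → A u v ≡ A′ u v) → InCW k A → InCW k A′
InCW-resp A≡A′ (e , A≅e) = e , IsoTo-respˡ {B = cwAdj e} A≡A′ A≅e

IsoTo-LC : ∀ {n m} {A : Adj n} {B B′ : Adj m} (x : Fin n) (f : Fin n ↔ Fin m) →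
  (∀ u v → A u v ≡ B (to f u) (to f v)) → Irreflexive B → Irreflexive B′ →
  SameEdges B′ (complementOn (B (to f x)) B) → IsoTo (LC A x) B′
IsoTo-LC {A = A} {B} {B′} x f A≅B B-irr B′-irr B′≐ = f , edges
  where
  edges : ∀ u v → LC A x u v ≡ B′ (to f u) (to f v)
  edges u v = byCases (u ≟ v)
    where
    byCases : Dec (u ≡ v) → LC A x u v ≡ B′ (to f u) (to f v)
    byCases (yes refl) = begin
      LC A x u u           ≡⟨ LC-diagonal A x u ⟩
      A u u                ≡⟨ A≅B u u ⟩
      B (to f u) (to f u)  ≡⟨ B-irr (to f u) ⟩
      false                ≡⟨ B′-irr (to f u) ⟨
      B′ (to f u) (to f u) ∎
    byCases (no u≢v) = begin
      LC A x u v
        ≡⟨ LC-sameEdges A x u≢v ⟩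
      complementOn (A x) A u v
        ≡⟨ cong₂ _xor_ (cong₂ _∧_ (A≅B x u) (A≅B x v)) (A≅B u v) ⟩
      complementOn (B (to f x)) B (to f u) (to f v)
        ≡⟨ B′≐ (u≢v ∘ Injection.injective (↔⇒↣ f)) ⟨
      B′ (to f u) (to f v) ∎

mark : ∀ {t} → Bool → Fin (2 + t)
mark false = zero
mark true  = suc zero

marked : ∀ {t} → Fin (suc t) → Bool
marked zero    = false
marked (suc _) = true

marked-mark : ∀ {t} b → marked (mark {t} b) ≡ b
marked-mark false = refl
marked-mark true  = refl

module Labels (t k : ℕ) where

  Label : Set
  Label = Fin ((2 + t) * k)

  tag : Label → Fin (2 + t)
  tag = quotient k

  base : Label → Fin k
  base = remainder {2 + t} k

  tag-combine : ∀ (s : Fin (2 + t)) (a : Fin k) → tag (combine s a) ≡ s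
  tag-combine s a = cong proj₁ (remQuot-combine s a)

  base-combine : ∀ (s : Fin (2 + t)) (a : Fin k) → base (combine s a) ≡ a
  base-combine s a = cong proj₂ (remQuot-combine s a)

  withMark : Bool → Fin k → Label
  withMark b = combine {2 + t} (mark b)

  marked-withMark : ∀ b a → marked (tag (withMark b a)) ≡ b
  marked-withMark b a = trans (cong marked (tag-combine (mark b) a)) (marked-mark b)

  mapPair : (Fin (2 + t) → Fin (2 + t)) → (Fin k → Fin k) → Label → Label
  mapPair σ τ i = combine (σ (tag i)) (τ (base i))

  mapPair-combine : ∀ σ τ (s : Fin (2 + t)) (a : Fin k) → mapPair σ τ (combine s a) ≡ combine (σ s) (τ a)
  mapPair-combine σ τ s a = cong₂ (λ s a → combine (σ s) (τ a)) (tag-combine s a) (base-combine s a)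

  mapPair-idem : ∀ σ τ → (∀ s → σ (σ s) ≡ σ s) → (∀ a → τ (τ a) ≡ τ a) →
    ∀ i → mapPair σ τ (mapPair σ τ i) ≡ mapPair σ τ i
  mapPair-idem σ τ σ-idem τ-idem i =
    trans (mapPair-combine σ τ _ _) (cong₂ combine (σ-idem (tag i)) (τ-idem (base i)))

nlcAdj-irreflexive : ∀ {k n} (e : NLCExpr k n) → Irreflexive (nlcAdj e)
nlcAdj-irreflexive (vtx a)        zero = refl
nlcAdj-irreflexive (join S e₁ e₂) u    = union-irreflexive (nlcAdj-irreflexive e₁) (nlcAdj-irreflexive e₂) u
nlcAdj-irreflexive (relab R e)    u    = nlcAdj-irreflexive e u

module _ {k : ℕ} where

  open Labels 0 k

  toggleMarked : (Fin k → Fin k → Bool) → Label → Label → Bool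
  toggleMarked S i j = (marked (tag i) ∧ marked (tag j)) xor S (base i) (base j)

  toggleMarked-withMark : ∀ S b a b′ a′ →
    toggleMarked S (withMark b a) (withMark b′ a′) ≡ (b ∧ b′) xor S a a′
  toggleMarked-withMark S b a b′ a′ =
    cong₂ _xor_ (cong₂ _∧_ (marked-withMark b a) (marked-withMark b′ a′))
                (cong₂ S (base-combine (mark b) a) (base-combine (mark b′) a′))

  nlcComplementOn : ∀ {n} → NLCExpr k n → (Fin n → Bool) → NLCExpr (2 * k) n
  nlcComplementOn (vtx a)                N = vtx (withMark (N zero) a)
  nlcComplementOn (join {m} {n} S e₁ e₂) N =
    join (toggleMarked S) (nlcComplementOn e₁ (N ∘ (_↑ˡ n))) (nlcComplementOn e₂ (N ∘ (m ↑ʳ_)))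
  nlcComplementOn (relab R e)            N = relab (mapPair id R) (nlcComplementOn e N)

  nlcLab-nlcComplementOn : ∀ {n} (e : NLCExpr k n) N v →
    nlcLab (nlcComplementOn e N) v ≡ withMark (N v) (nlcLab e v)
  nlcLab-nlcComplementOn (vtx a) N zero = refl
  nlcLab-nlcComplementOn (join {m} {n} S e₁ e₂) N v with split m v
  ... | left i  = trans (joinLab-ˡ {m} i)
    (trans (nlcLab-nlcComplementOn e₁ (N ∘ (_↑ˡ n)) i)
           (cong (withMark (N (i ↑ˡ n))) (sym (joinLab-ˡ {m} i))))
  ... | right j = trans (joinLab-ʳ {m} j)
    (trans (nlcLab-nlcComplementOn e₂ (N ∘ (m ↑ʳ_)) j)
           (cong (withMark (N (m ↑ʳ j))) (sym (joinLab-ʳ {m} j))))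
  nlcLab-nlcComplementOn (relab R e) N v =
    trans (cong (mapPair id R) (nlcLab-nlcComplementOn e N v))
          (mapPair-combine id R (mark (N v)) (nlcLab e v))

  nlcAdj-nlcComplementOn : ∀ {n} (e : NLCExpr k n) N →
    SameEdges (nlcAdj (nlcComplementOn e N)) (complementOn N (nlcAdj e))
  nlcAdj-nlcComplementOn (vtx a)     N {zero} {zero} 0≢0 = contradiction refl 0≢0
  nlcAdj-nlcComplementOn (relab R e) N = nlcAdj-nlcComplementOn e N
  nlcAdj-nlcComplementOn (join {m} {n} S e₁ e₂) N {u} {v} u≢v = trans
    (union-cong (nlcAdj-nlcComplementOn e₁ N₁) (nlcAdj-nlcComplementOn e₂ N₂) cross u≢v)
    (sym (complementOn-union {m} N u v))
    where
    N₁ : Fin m → Bool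
    N₁ = N ∘ (_↑ˡ n)
    N₂ : Fin n → Bool
    N₂ = N ∘ (m ↑ʳ_)
    cross : ∀ i j → toggleMarked S (nlcLab (nlcComplementOn e₁ N₁) i) (nlcLab (nlcComplementOn e₂ N₂) j)
                  ≡ (N₁ i ∧ N₂ j) xor S (nlcLab e₁ i) (nlcLab e₂ j)
    cross i j = trans
      (cong₂ (toggleMarked S) (nlcLab-nlcComplementOn e₁ N₁ i) (nlcLab-nlcComplementOn e₂ N₂ j))
      (toggleMarked-withMark S (N₁ i) (nlcLab e₁ i) (N₂ j) (nlcLab e₂ j))

LC-InNLC : ∀ {k n} {A : Adj n} (x : Fin n) → InNLC k A → InNLC (2 * k) (LC A x)
LC-InNLC {n = n} x (e , f , A≅e) = nlcComplementOn e N , IsoTo-LC {B = nlcAdj e} x f A≅e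
  (nlcAdj-irreflexive e) (nlcAdj-irreflexive (nlcComplementOn e N)) (nlcAdj-nlcComplementOn e N)
  where
  N : Fin n → Bool
  N = nlcAdj e (to f x)

linked : ∀ {k} → Fin k → Fin k → Fin k → Fin k → Bool
linked a b p q = ((p == a) ∧ (q == b)) ∨ ((p == b) ∧ (q == a))

linked-sym : ∀ {k} (a b p q : Fin k) → linked a b p q ≡ linked a b q p
linked-sym a b p q = trans (∨-comm ((p == a) ∧ (q == b)) _)
                           (cong₂ _∨_ (∧-comm (p == b) (q == a)) (∧-comm (p == a) (q == b)))

linked-self : ∀ {k} (a b : Fin k) → T (linked a b a b)
linked-self a b rewrite ==-refl a | ==-refl b = _

linked-irrefl : ∀ {k} {a b : Fin k} → a ≢ b → ∀ c → linked a b c c ≡ false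
linked-irrefl a≢b c rewrite ==-∧-==-≢ a≢b c | ==-∧-==-≢ (a≢b ∘ sym) c = refl

cwAdj-irreflexive : ∀ {k n} (e : CWExpr k n) → Irreflexive (cwAdj e)
cwAdj-irreflexive (vtx a)       zero = refl
cwAdj-irreflexive (e₁ ⊕ e₂)     u    = union-irreflexive (cwAdj-irreflexive e₁) (cwAdj-irreflexive e₂) u
cwAdj-irreflexive (ρ a b _ e)   u    = cwAdj-irreflexive e u
cwAdj-irreflexive (η a b a≢b e) u rewrite cwAdj-irreflexive e u = linked-irrefl a≢b (cwLab e u)

-- Renaming each label c with R c ≢ c to R c, one at a time, realises the idempotent map R:
-- every target R c is a fixed point of R and is never renamed again.
module _ {k : ℕ} (R : Fin k → Fin k) (R-idem : ∀ c → R (R c) ≡ R c) where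

  relabelAlong : ∀ {n} → List (Fin k) → CWExpr k n → CWExpr k n
  relabelAlong []       e = e
  relabelAlong (c ∷ cs) e with c ≟ R c
  ... | yes _    = relabelAlong cs e
  ... | no c≢Rc = relabelAlong cs (ρ c (R c) c≢Rc e)

  cwAdj-relabelAlong : ∀ {n} cs (e : CWExpr k n) u v → cwAdj (relabelAlong cs e) u v ≡ cwAdj e u v
  cwAdj-relabelAlong []       e u v = refl
  cwAdj-relabelAlong (c ∷ cs) e u v with c ≟ R c
  ... | yes _    = cwAdj-relabelAlong cs e u v
  ... | no c≢Rc = cwAdj-relabelAlong cs (ρ c (R c) c≢Rc e) u v

  QueuedOrFixed : List (Fin k) → Fin k → Set
  QueuedOrFixed cs l = l ∈ cs ⊎ R l ≡ l

  cwLab-relabelAlong : ∀ {n} cs (e : CWExpr k n) → (∀ v → QueuedOrFixed cs (cwLab e v)) →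
    ∀ v → cwLab (relabelAlong cs e) v ≡ R (cwLab e v)
  cwLab-relabelAlong [] e settled v with settled v
  ... | inj₂ fixed = sym fixed
  cwLab-relabelAlong (c ∷ cs) e settled v with c ≟ R c
  ... | yes c≡Rc = cwLab-relabelAlong cs e settled′ v
    where
    settled′ : ∀ v → QueuedOrFixed cs (cwLab e v)
    settled′ v with settled v
    ... | inj₁ (here refl)  = inj₂ (sym c≡Rc)
    ... | inj₁ (there l∈cs) = inj₁ l∈cs
    ... | inj₂ fixed        = inj₂ fixed
  ... | no c≢Rc = trans (cwLab-relabelAlong cs e′ settled′ v) R-step
    where
    e′ : CWExpr k _
    e′ = ρ c (R c) c≢Rc e
    settled′ : ∀ v → QueuedOrFixed cs (cwLab e′ v)
    settled′ v with cwLab e v ≟ c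
    ... | yes _   = inj₂ (R-idem c)
    ... | no l≢c with settled v
    ...   | inj₁ (here l≡c)   = contradiction l≡c l≢c
    ...   | inj₁ (there l∈cs) = inj₁ l∈cs
    ...   | inj₂ fixed        = inj₂ fixed
    R-step : R (cwLab e′ v) ≡ R (cwLab e v)
    R-step with cwLab e v ≟ c
    ... | yes l≡c = trans (R-idem c) (cong R (sym l≡c))
    ... | no _    = refl

  relabel : ∀ {n} → CWExpr k n → CWExpr k n
  relabel = relabelAlong (allFin k)

  cwLab-relabel : ∀ {n} (e : CWExpr k n) v → cwLab (relabel e) v ≡ R (cwLab e v)
  cwLab-relabel e = cwLab-relabelAlong (allFin k) e (λ v → inj₁ (∈-allFin (cwLab e v)))

  cwAdj-relabel : ∀ {n} (e : CWExpr k n) u v → cwAdj (relabel e) u v ≡ cwAdj e u v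
  cwAdj-relabel = cwAdj-relabelAlong (allFin k)

T-ext : ∀ {x y} → (T x → T y) → (T y → T x) → x ≡ y
T-ext x⇒y y⇒x =
  ⇔→≡ {z = true} (mk⇔ (to⇔ T-≡ ∘ x⇒y ∘ from⇔ T-≡) (to⇔ T-≡ ∘ y⇒x ∘ from⇔ T-≡))

linked-sound : ∀ {k} {i j a b : Fin k} → T (linked i j a b) → (a ≡ i × b ≡ j) ⊎ (a ≡ j × b ≡ i)
linked-sound {k} = Sum.map both both ∘ to⇔ T-∨
  where
  both : ∀ {x x′ y y′ : Fin k} → T ((x == x′) ∧ (y == y′)) → x ≡ x′ × y ≡ y′
  both {x} {x′} {y} {y′} =
    Product.map (toWitness {a? = x ≟ x′}) (toWitness {a? = y ≟ y′}) ∘ to⇔ (T-∧ {x == x′})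

module _ {k : ℕ} (P : Fin k → Fin k → Bool) (P-irrefl : ∀ c → P c c ≡ false) where

  private
    P⇒≢ : ∀ {i j} → P i j ≡ true → i ≢ j
    P⇒≢ {i} Pii≡true refl with trans (sym Pii≡true) (P-irrefl i)
    ... | ()

  joinWhen : ∀ {n} i j b → P i j ≡ b → CWExpr k n → CWExpr k n
  joinWhen i j true  Pij e = η i j (P⇒≢ Pij) e
  joinWhen i j false _   e = e

  cwLab-joinWhen : ∀ {n} i j b Pij (e : CWExpr k n) v → cwLab (joinWhen i j b Pij e) v ≡ cwLab e v
  cwLab-joinWhen i j true  _ e v = refl
  cwLab-joinWhen i j false _ e v = refl

  cwAdj-joinWhen : ∀ {n} i j b Pij (e : CWExpr k n) u v →
    cwAdj (joinWhen i j b Pij e) u v ≡ cwAdj e u v ∨ (b ∧ linked i j (cwLab e u) (cwLab e v))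
  cwAdj-joinWhen i j true  _ e u v = refl
  cwAdj-joinWhen i j false _ e u v = sym (∨-identityʳ (cwAdj e u v))

  joinIf : ∀ {n} → Fin k → Fin k → CWExpr k n → CWExpr k n
  joinIf i j = joinWhen i j (P i j) refl

  cwLab-joinIf : ∀ {n} i j (e : CWExpr k n) v → cwLab (joinIf i j e) v ≡ cwLab e v
  cwLab-joinIf i j = cwLab-joinWhen i j (P i j) refl

  cwAdj-joinIf : ∀ {n} i j (e : CWExpr k n) u v →
    cwAdj (joinIf i j e) u v ≡ cwAdj e u v ∨ (P i j ∧ linked i j (cwLab e u) (cwLab e v))
  cwAdj-joinIf i j = cwAdj-joinWhen i j (P i j) refl

  joins : Fin k → Fin k → Fin k × Fin k → Bool
  joins a b (i , j) = P i j ∧ linked i j a b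

  addEdgesAlong : ∀ {n} → List (Fin k × Fin k) → CWExpr k n → CWExpr k n
  addEdgesAlong []             e = e
  addEdgesAlong ((i , j) ∷ ps) e = addEdgesAlong ps (joinIf i j e)

  cwLab-addEdgesAlong : ∀ {n} ps (e : CWExpr k n) v → cwLab (addEdgesAlong ps e) v ≡ cwLab e v
  cwLab-addEdgesAlong []             e v = refl
  cwLab-addEdgesAlong ((i , j) ∷ ps) e v =
    trans (cwLab-addEdgesAlong ps (joinIf i j e) v) (cwLab-joinIf i j e v)

  cwAdj-addEdgesAlong : ∀ {n} ps (e : CWExpr k n) u v →
    cwAdj (addEdgesAlong ps e) u v ≡ cwAdj e u v ∨ any (joins (cwLab e u) (cwLab e v)) ps
  cwAdj-addEdgesAlong []             e u v = sym (∨-identityʳ (cwAdj e u v))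
  cwAdj-addEdgesAlong ((i , j) ∷ ps) e u v = begin
    cwAdj (addEdgesAlong ps e′) u v
      ≡⟨ cwAdj-addEdgesAlong ps e′ u v ⟩
    cwAdj e′ u v ∨ any (joins (cwLab e′ u) (cwLab e′ v)) ps
      ≡⟨ cong₂ _∨_ (cwAdj-joinIf i j e u v)
                   (cong₂ (λ a b → any (joins a b) ps) (cwLab-joinIf i j e u) (cwLab-joinIf i j e v)) ⟩
    (cwAdj e u v ∨ joins (cwLab e u) (cwLab e v) (i , j)) ∨ any (joins (cwLab e u) (cwLab e v)) ps
      ≡⟨ ∨-assoc (cwAdj e u v) _ _ ⟩
    cwAdj e u v ∨ any (joins (cwLab e u) (cwLab e v)) ((i , j) ∷ ps) ∎
    where
    e′ : CWExpr k _
    e′ = joinIf i j e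

  allPairs : List (Fin k × Fin k)
  allPairs = cartesianProduct (allFin k) (allFin k)

  any-joins-allPairs : ∀ a b → any (joins a b) allPairs ≡ P a b ∨ P b a
  any-joins-allPairs a b = T-ext sound complete
    where
    sound : T (any (joins a b) allPairs) → T (P a b ∨ P b a)
    sound h with satisfied (any⁻ (joins a b) allPairs h)
    ... | (i , j) , hit with to⇔ T-∧ hit
    ...   | Pij , link with linked-sound {i = i} {j} {a} {b} link
    ...     | inj₁ (refl , refl) = from⇔ T-∨ (inj₁ Pij)
    ...     | inj₂ (refl , refl) = from⇔ T-∨ (inj₂ Pij)
    hitAt : ∀ i j → T (joins a b (i , j)) → T (any (joins a b) allPairs)
    hitAt i j = any⁺ (joins a b) ∘ lose (∈-cartesianProduct⁺ (∈-allFin i) (∈-allFin j))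
    complete : T (P a b ∨ P b a) → T (any (joins a b) allPairs)
    complete h with to⇔ (T-∨ {P a b}) h
    ... | inj₁ Pab = hitAt a b (from⇔ (T-∧ {P a b}) (Pab , linked-self a b))
    ... | inj₂ Pba = hitAt b a (from⇔ (T-∧ {P b a}) (Pba , subst T (linked-sym b a b a) (linked-self b a)))

  addEdges : ∀ {n} → CWExpr k n → CWExpr k n
  addEdges = addEdgesAlong allPairs

  cwLab-addEdges : ∀ {n} (e : CWExpr k n) v → cwLab (addEdges e) v ≡ cwLab e v
  cwLab-addEdges = cwLab-addEdgesAlong allPairs

  cwAdj-addEdges : ∀ {n} (e : CWExpr k n) u v →
    cwAdj (addEdges e) u v ≡ cwAdj e u v ∨ P (cwLab e u) (cwLab e v) ∨ P (cwLab e v) (cwLab e u)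
  cwAdj-addEdges e u v =
    trans (cwAdj-addEdgesAlong allPairs e u v) (cong (cwAdj e u v ∨_) (any-joins-allPairs _ _))

rename : ∀ {k} → Fin k → Fin k → Fin k → Fin k
rename a b c = if c == a then b else c

rename-idem : ∀ {k} (a b : Fin k) c → rename a b (rename a b c) ≡ rename a b c
rename-idem a b c with c ≟ a
... | yes _ with b ≟ a
...   | yes _ = refl
...   | no _  = refl
rename-idem a b c | no c≢a rewrite ==-≢ c≢a = refl

-- The tag of a label in the clique-width translation: 0 outside N, 1 inside N, and 2 inside N
-- and in the right operand of the ⊕ being translated.
park : Fin 3 → Fin 3
park (suc zero) = suc (suc zero)
park s          = s

unpark : Fin 3 → Fin 3
unpark (suc (suc zero)) = suc zero
unpark s                = s

park-idem : ∀ s → park (park s) ≡ park s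
park-idem zero             = refl
park-idem (suc zero)       = refl
park-idem (suc (suc zero)) = refl

unpark-idem : ∀ s → unpark (unpark s) ≡ unpark s
unpark-idem zero             = refl
unpark-idem (suc zero)       = refl
unpark-idem (suc (suc zero)) = refl

unpark-mark : ∀ b → unpark (mark b) ≡ mark b
unpark-mark false = refl
unpark-mark true  = refl

unpark-park-mark : ∀ b → unpark (park (mark b)) ≡ mark b
unpark-park-mark false = refl
unpark-park-mark true  = refl

crosses : Fin 3 → Fin 3 → Bool
crosses (suc zero) (suc (suc zero)) = true
crosses _          _                = false

crosses-irrefl : ∀ s → crosses s s ≡ false
crosses-irrefl zero             = refl
crosses-irrefl (suc zero)       = refl
crosses-irrefl (suc (suc zero)) = refl

crosses-mark-mark : ∀ b b′ → crosses (mark b) (mark b′) ≡ false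
crosses-mark-mark false _     = refl
crosses-mark-mark true  false = refl
crosses-mark-mark true  true  = refl

crosses-park-park : ∀ b b′ → crosses (park (mark b)) (park (mark b′)) ≡ false
crosses-park-park false _     = refl
crosses-park-park true  false = refl
crosses-park-park true  true  = refl

crosses-mark-park : ∀ b b′ → crosses (mark b) (park (mark b′)) ≡ b ∧ b′
crosses-mark-park false _     = refl
crosses-mark-park true  false = refl
crosses-mark-park true  true  = refl

crosses-park-mark : ∀ b b′ → crosses (park (mark b)) (mark b′) ≡ false
crosses-park-mark false _     = refl
crosses-park-mark true  false = refl
crosses-park-mark true  true  = refl

expectedEdge : Bool → Bool → Bool → Bool
expectedEdge inside edge pending = if inside then not (edge ∨ pending) else edge

expectedEdge-nothingPending : ∀ c a → expectedEdge c a false ≡ c xor a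
expectedEdge-nothingPending true  a = cong not (∨-identityʳ a)
expectedEdge-nothingPending false a = refl

expectedEdge-noEdge : ∀ c p → expectedEdge c false p ≡ c ∧ not p
expectedEdge-noEdge true  p = refl
expectedEdge-noEdge false p = refl

expectedEdge-η : ∀ x y e f p q p′ q′ →
  expectedEdge (x ∧ y) e (((p ∧ q) ∨ (p′ ∧ q′)) ∨ f)
    ∨ (not (x ∧ y) ∧ (p ∧ q)) ∨ (not (y ∧ x) ∧ (q′ ∧ p′))
  ≡ expectedEdge (x ∧ y) (e ∨ (p ∧ q) ∨ (p′ ∧ q′)) f
expectedEdge-η true  true  e f p q p′ q′ =
  trans (∨-identityʳ _) (cong not (sym (∨-assoc e _ f)))
expectedEdge-η true  false e f p q p′ q′ = cong (λ z → e ∨ (p ∧ q) ∨ z) (∧-comm q′ p′)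
expectedEdge-η false true  e f p q p′ q′ = cong (λ z → e ∨ (p ∧ q) ∨ z) (∧-comm q′ p′)
expectedEdge-η false false e f p q p′ q′ = cong (λ z → e ∨ (p ∧ q) ∨ z) (∧-comm q′ p′)

module _ {k : ℕ} where

  open Labels 1 k

  η-pairs : Fin k → Fin k → Label → Label → Bool
  η-pairs a b i j = not (marked (tag i) ∧ marked (tag j)) ∧ ((base i == a) ∧ (base j == b))

  η-pairs-irrefl : ∀ {a b} → a ≢ b → ∀ i → η-pairs a b i i ≡ false
  η-pairs-irrefl a≢b i rewrite ==-∧-==-≢ a≢b (base i) = ∧-zeroʳ _

  η-pairs-withMark : ∀ a b x p y q →
    η-pairs a b (withMark x p) (withMark y q) ≡ not (x ∧ y) ∧ ((p == a) ∧ (q == b))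
  η-pairs-withMark a b x p y q =
    cong₂ (λ m l → not m ∧ l) (cong₂ _∧_ (marked-withMark x p) (marked-withMark y q))
      (cong₂ (λ p q → (p == a) ∧ (q == b)) (base-combine (mark x) p) (base-combine (mark y) q))

  ⊕-pairs : (Fin k → Fin k → Bool) → Label → Label → Bool
  ⊕-pairs F i j = crosses (tag i) (tag j) ∧ not (F (base i) (base j))

  ⊕-pairs-irrefl : ∀ F i → ⊕-pairs F i i ≡ false
  ⊕-pairs-irrefl F i rewrite crosses-irrefl (tag i) = refl

  ⊕-pairs-combine : ∀ F s p s′ q →
    ⊕-pairs F (combine s p) (combine s′ q) ≡ crosses s s′ ∧ not (F p q)
  ⊕-pairs-combine F s p s′ q =
    cong₂ (λ c f → c ∧ not f) (cong₂ crosses (tag-combine s p) (tag-combine s′ q))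
                              (cong₂ F (base-combine s p) (base-combine s′ q))

  parkLabel : Label → Label
  parkLabel = mapPair park id

  unparkLabel : Label → Label
  unparkLabel = mapPair unpark id

  renameBase : Fin k → Fin k → Label → Label
  renameBase a b = mapPair id (rename a b)

  parkLabel-idem : ∀ i → parkLabel (parkLabel i) ≡ parkLabel i
  parkLabel-idem = mapPair-idem park id park-idem (λ _ → refl)

  unparkLabel-idem : ∀ i → unparkLabel (unparkLabel i) ≡ unparkLabel i
  unparkLabel-idem = mapPair-idem unpark id unpark-idem (λ _ → refl)

  renameBase-idem : ∀ a b i → renameBase a b (renameBase a b i) ≡ renameBase a b i
  renameBase-idem a b = mapPair-idem id (rename a b) (λ _ → refl) (rename-idem a b)

  merge : ∀ {m n} → (Fin k → Fin k → Bool) → CWExpr (3 * k) m → CWExpr (3 * k) n → CWExpr (3 * k) (m + n)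
  merge F E₁ E₂ =
    relabel unparkLabel unparkLabel-idem
      (addEdges (⊕-pairs F) (⊕-pairs-irrefl F) (E₁ ⊕ relabel parkLabel parkLabel-idem E₂))

  crossEdges : ∀ {m n} → (Fin (m + n) → Bool) → (Fin k → Fin k → Bool) →
    (Fin m → Fin k) → (Fin n → Fin k) → Fin m → Fin n → Bool
  crossEdges {m} {n} N F ℓ₁ ℓ₂ i j = (N (i ↑ˡ n) ∧ N (m ↑ʳ j)) ∧ not (F (ℓ₁ i) (ℓ₂ j))

  module _ (F : Fin k → Fin k → Bool) {m n} (N : Fin (m + n) → Bool)
           (ℓ₁ : Fin m → Fin k) (ℓ₂ : Fin n → Fin k) {E₁ : CWExpr (3 * k) m} {E₂ : CWExpr (3 * k) n}
           (lab₁ : ∀ i → cwLab E₁ i ≡ withMark (N (i ↑ˡ n)) (ℓ₁ i))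
           (lab₂ : ∀ j → cwLab E₂ j ≡ withMark (N (m ↑ʳ j)) (ℓ₂ j)) where

    private
      Nˡ : Fin m → Bool
      Nˡ i = N (i ↑ˡ n)

      Nʳ : Fin n → Bool
      Nʳ j = N (m ↑ʳ j)

      U : CWExpr (3 * k) (m + n)
      U = E₁ ⊕ relabel parkLabel parkLabel-idem E₂

      U-lab-ˡ : ∀ i → cwLab U (i ↑ˡ n) ≡ withMark (Nˡ i) (ℓ₁ i)
      U-lab-ˡ i = trans (joinLab-ˡ {m} i) (lab₁ i)

      U-lab-ʳ : ∀ j → cwLab U (m ↑ʳ j) ≡ combine (park (mark (Nʳ j))) (ℓ₂ j)
      U-lab-ʳ j = begin
        cwLab U (m ↑ʳ j)                              ≡⟨ joinLab-ʳ {m} j ⟩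
        cwLab (relabel parkLabel parkLabel-idem E₂) j ≡⟨ cwLab-relabel parkLabel parkLabel-idem E₂ j ⟩
        parkLabel (cwLab E₂ j)                        ≡⟨ cong parkLabel (lab₂ j) ⟩
        parkLabel (withMark (Nʳ j) (ℓ₂ j))            ≡⟨ mapPair-combine park id (mark (Nʳ j)) (ℓ₂ j) ⟩
        combine (park (mark (Nʳ j))) (ℓ₂ j)           ∎

      U-adj-ʳʳ : ∀ i j → cwAdj U (m ↑ʳ i) (m ↑ʳ j) ≡ cwAdj E₂ i j
      U-adj-ʳʳ i j = trans (union-ʳʳ {m} i j) (cwAdj-relabel parkLabel parkLabel-idem E₂ i j)

      merge-adj : ∀ u v {s p s′ q a c c′} → cwLab U u ≡ combine s p → cwLab U v ≡ combine s′ q →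
        cwAdj U u v ≡ a → crosses s s′ ≡ c → crosses s′ s ≡ c′ →
        cwAdj (merge F E₁ E₂) u v ≡ a ∨ (c ∧ not (F p q)) ∨ (c′ ∧ not (F q p))
      merge-adj u v {s} {p} {s′} {q} {a} {c} {c′} labu labv adj cr cr′ = begin
        cwAdj (merge F E₁ E₂) u v
          ≡⟨ cwAdj-relabel unparkLabel unparkLabel-idem _ u v ⟩
        cwAdj (addEdges (⊕-pairs F) (⊕-pairs-irrefl F) U) u v
          ≡⟨ cwAdj-addEdges (⊕-pairs F) (⊕-pairs-irrefl F) U u v ⟩
        cwAdj U u v ∨ ⊕-pairs F (cwLab U u) (cwLab U v) ∨ ⊕-pairs F (cwLab U v) (cwLab U u)
          ≡⟨ cong₂ (λ x y → cwAdj U u v ∨ x ∨ y)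
               (trans (cong₂ (⊕-pairs F) labu labv) (⊕-pairs-combine F s p s′ q))
               (trans (cong₂ (⊕-pairs F) labv labu) (⊕-pairs-combine F s′ q s p)) ⟩
        cwAdj U u v ∨ (crosses s s′ ∧ not (F p q)) ∨ (crosses s′ s ∧ not (F q p))
          ≡⟨ cong₂ _∨_ adj (cong₂ (λ c c′ → (c ∧ not (F p q)) ∨ (c′ ∧ not (F q p))) cr cr′) ⟩
        a ∨ (c ∧ not (F p q)) ∨ (c′ ∧ not (F q p)) ∎

    cwLab-merge : ∀ v → cwLab (merge F E₁ E₂) v ≡ withMark (N v) (joinLab ℓ₁ ℓ₂ v)
    cwLab-merge v = trans (cwLab-relabel unparkLabel unparkLabel-idem _ v)
                          (trans (cong unparkLabel (cwLab-addEdges (⊕-pairs F) (⊕-pairs-irrefl F) U v))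
                                 (byPosition (split m v)))
      where
      byPosition : ∀ {v} → Split m n v → unparkLabel (cwLab U v) ≡ withMark (N v) (joinLab ℓ₁ ℓ₂ v)
      byPosition (left i) = begin
        unparkLabel (cwLab U (i ↑ˡ n))              ≡⟨ cong unparkLabel (U-lab-ˡ i) ⟩
        unparkLabel (withMark (Nˡ i) (ℓ₁ i))        ≡⟨ mapPair-combine unpark id (mark (Nˡ i)) (ℓ₁ i) ⟩
        combine (unpark (mark (Nˡ i))) (ℓ₁ i)       ≡⟨ cong (λ s → combine s (ℓ₁ i)) (unpark-mark (Nˡ i)) ⟩
        withMark (Nˡ i) (ℓ₁ i)                      ≡⟨ cong (withMark (Nˡ i)) (joinLab-ˡ {m} i) ⟨
        withMark (Nˡ i) (joinLab ℓ₁ ℓ₂ (i ↑ˡ n))    ∎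
      byPosition (right j) = begin
        unparkLabel (cwLab U (m ↑ʳ j))               ≡⟨ cong unparkLabel (U-lab-ʳ j) ⟩
        unparkLabel (combine (park (mark (Nʳ j))) (ℓ₂ j))
          ≡⟨ mapPair-combine unpark id (park (mark (Nʳ j))) (ℓ₂ j) ⟩
        combine (unpark (park (mark (Nʳ j)))) (ℓ₂ j) ≡⟨ cong (λ s → combine s (ℓ₂ j)) (unpark-park-mark (Nʳ j)) ⟩
        withMark (Nʳ j) (ℓ₂ j)                       ≡⟨ cong (withMark (Nʳ j)) (joinLab-ʳ {m} j) ⟨
        withMark (Nʳ j) (joinLab ℓ₁ ℓ₂ (m ↑ʳ j))     ∎

    cwAdj-merge : ∀ u v → cwAdj (merge F E₁ E₂) u v ≡ union (cwAdj E₁) (cwAdj E₂) (crossEdges N F ℓ₁ ℓ₂) u v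
    cwAdj-merge = union-unique ˡˡ ʳʳ ˡʳ ʳˡ
      where
      ˡˡ : ∀ i j → cwAdj (merge F E₁ E₂) (i ↑ˡ n) (j ↑ˡ n) ≡ cwAdj E₁ i j
      ˡˡ i j = trans (merge-adj (i ↑ˡ n) (j ↑ˡ n) (U-lab-ˡ i) (U-lab-ˡ j) (union-ˡˡ {m} i j)
                       (crosses-mark-mark (Nˡ i) (Nˡ j)) (crosses-mark-mark (Nˡ j) (Nˡ i)))
                     (∨-identityʳ (cwAdj E₁ i j))
      ʳʳ : ∀ i j → cwAdj (merge F E₁ E₂) (m ↑ʳ i) (m ↑ʳ j) ≡ cwAdj E₂ i j
      ʳʳ i j = trans (merge-adj (m ↑ʳ i) (m ↑ʳ j) (U-lab-ʳ i) (U-lab-ʳ j) (U-adj-ʳʳ i j)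
                       (crosses-park-park (Nʳ i) (Nʳ j)) (crosses-park-park (Nʳ j) (Nʳ i)))
                     (∨-identityʳ (cwAdj E₂ i j))
      ˡʳ : ∀ i j → cwAdj (merge F E₁ E₂) (i ↑ˡ n) (m ↑ʳ j) ≡ crossEdges N F ℓ₁ ℓ₂ i j
      ˡʳ i j = trans (merge-adj (i ↑ˡ n) (m ↑ʳ j) (U-lab-ˡ i) (U-lab-ʳ j) (union-ˡʳ {m} i j)
                       (crosses-mark-park (Nˡ i) (Nʳ j)) (crosses-park-mark (Nʳ j) (Nˡ i)))
                     (∨-identityʳ (crossEdges N F ℓ₁ ℓ₂ i j))
      ʳˡ : ∀ i j → cwAdj (merge F E₁ E₂) (m ↑ʳ j) (i ↑ˡ n) ≡ crossEdges N F ℓ₁ ℓ₂ i j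
      ʳˡ i j = merge-adj (m ↑ʳ j) (i ↑ˡ n) (U-lab-ʳ j) (U-lab-ˡ i) (union-ʳˡ {m} i j)
                 (crosses-park-mark (Nʳ j) (Nˡ i)) (crosses-mark-park (Nˡ i) (Nʳ j))

  -- In cwComplementOn e N F, the relation F holds of the label pairs that the expression
  -- around e will still join by η.  Inside N the translation already shows the complement of
  -- that final graph; outside N it shows e itself and leaves the later edges to the
  -- translated η, which joins no two vertices of N.
  pending-ρ : Fin k → Fin k → (Fin k → Fin k → Bool) → Fin k → Fin k → Bool
  pending-ρ a b F p q = F (rename a b p) (rename a b q)

  pending-η : Fin k → Fin k → (Fin k → Fin k → Bool) → Fin k → Fin k → Bool
  pending-η a b F p q = linked a b p q ∨ F p q

  cwComplementOn : ∀ {n} → CWExpr k n → (Fin n → Bool) → (Fin k → Fin k → Bool) → CWExpr (3 * k) n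
  cwComplementOn (vtx a)             N F = vtx (withMark (N zero) a)
  cwComplementOn (_⊕_ {m} {n} e₁ e₂) N F =
    merge F (cwComplementOn e₁ (N ∘ (_↑ˡ n)) F) (cwComplementOn e₂ (N ∘ (m ↑ʳ_)) F)
  cwComplementOn (ρ a b _ e)         N F =
    relabel (renameBase a b) (renameBase-idem a b) (cwComplementOn e N (pending-ρ a b F))
  cwComplementOn (η a b a≢b e)       N F =
    addEdges (η-pairs a b) (η-pairs-irrefl a≢b) (cwComplementOn e N (pending-η a b F))

  cwLab-cwComplementOn : ∀ {n} (e : CWExpr k n) N F v →
    cwLab (cwComplementOn e N F) v ≡ withMark (N v) (cwLab e v)
  cwLab-cwComplementOn (vtx a)             N F zero = refl
  cwLab-cwComplementOn (_⊕_ {m} {n} e₁ e₂) N F =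
    cwLab-merge F N (cwLab e₁) (cwLab e₂)
      (cwLab-cwComplementOn e₁ (N ∘ (_↑ˡ n)) F) (cwLab-cwComplementOn e₂ (N ∘ (m ↑ʳ_)) F)
  cwLab-cwComplementOn (ρ a b _ e)         N F v = begin
    cwLab (relabel (renameBase a b) (renameBase-idem a b) E) v
      ≡⟨ cwLab-relabel (renameBase a b) (renameBase-idem a b) E v ⟩
    renameBase a b (cwLab E v)
      ≡⟨ cong (renameBase a b) (cwLab-cwComplementOn e N (pending-ρ a b F) v) ⟩
    renameBase a b (withMark (N v) (cwLab e v))
      ≡⟨ mapPair-combine id (rename a b) (mark (N v)) (cwLab e v) ⟩
    withMark (N v) (rename a b (cwLab e v)) ∎
    where
    E : CWExpr (3 * k) _
    E = cwComplementOn e N (pending-ρ a b F)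
  cwLab-cwComplementOn (η a b a≢b e)       N F v = trans
    (cwLab-addEdges (η-pairs a b) (η-pairs-irrefl a≢b) (cwComplementOn e N (pending-η a b F)) v)
    (cwLab-cwComplementOn e N (pending-η a b F) v)

  pendingComplement : ∀ {n} → (Fin n → Bool) → (Fin k → Fin k → Bool) → CWExpr k n → Adj n
  pendingComplement N F e u v = expectedEdge (N u ∧ N v) (cwAdj e u v) (F (cwLab e u) (cwLab e v))

  pendingComplement-⊕ : ∀ {m n} (e₁ : CWExpr k m) (e₂ : CWExpr k n) N F → (∀ p q → F p q ≡ F q p) →
    ∀ u v → pendingComplement N F (e₁ ⊕ e₂) u v ≡
      union (pendingComplement (N ∘ (_↑ˡ n)) F e₁) (pendingComplement (N ∘ (m ↑ʳ_)) F e₂)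
            (crossEdges N F (cwLab e₁) (cwLab e₂)) u v
  pendingComplement-⊕ {m} {n} e₁ e₂ N F F-sym = union-unique ˡˡ ʳʳ ˡʳ ʳˡ
    where
    ℓ₁ : Fin m → Fin k
    ℓ₁ = cwLab e₁
    ℓ₂ : Fin n → Fin k
    ℓ₂ = cwLab e₂
    ˡˡ : ∀ i j → pendingComplement N F (e₁ ⊕ e₂) (i ↑ˡ n) (j ↑ˡ n) ≡
                 pendingComplement (N ∘ (_↑ˡ n)) F e₁ i j
    ˡˡ i j = cong₂ (expectedEdge (N (i ↑ˡ n) ∧ N (j ↑ˡ n)))
                   (union-ˡˡ {m} i j) (cong₂ F (joinLab-ˡ {m} i) (joinLab-ˡ {m} j))
    ʳʳ : ∀ i j → pendingComplement N F (e₁ ⊕ e₂) (m ↑ʳ i) (m ↑ʳ j) ≡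
                 pendingComplement (N ∘ (m ↑ʳ_)) F e₂ i j
    ʳʳ i j = cong₂ (expectedEdge (N (m ↑ʳ i) ∧ N (m ↑ʳ j)))
                   (union-ʳʳ {m} i j) (cong₂ F (joinLab-ʳ {m} i) (joinLab-ʳ {m} j))
    ˡʳ : ∀ i j → pendingComplement N F (e₁ ⊕ e₂) (i ↑ˡ n) (m ↑ʳ j) ≡ crossEdges N F ℓ₁ ℓ₂ i j
    ˡʳ i j = trans (cong₂ (expectedEdge (N (i ↑ˡ n) ∧ N (m ↑ʳ j)))
                          (union-ˡʳ {m} i j) (cong₂ F (joinLab-ˡ {m} i) (joinLab-ʳ {m} j)))
                   (expectedEdge-noEdge (N (i ↑ˡ n) ∧ N (m ↑ʳ j)) (F (ℓ₁ i) (ℓ₂ j)))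
    ʳˡ : ∀ i j → pendingComplement N F (e₁ ⊕ e₂) (m ↑ʳ j) (i ↑ˡ n) ≡ crossEdges N F ℓ₁ ℓ₂ i j
    ʳˡ i j = begin
      pendingComplement N F (e₁ ⊕ e₂) (m ↑ʳ j) (i ↑ˡ n)
        ≡⟨ cong₂ (expectedEdge (N (m ↑ʳ j) ∧ N (i ↑ˡ n)))
                 (union-ʳˡ {m} i j) (cong₂ F (joinLab-ʳ {m} j) (joinLab-ˡ {m} i)) ⟩
      expectedEdge (N (m ↑ʳ j) ∧ N (i ↑ˡ n)) false (F (ℓ₂ j) (ℓ₁ i))
        ≡⟨ expectedEdge-noEdge (N (m ↑ʳ j) ∧ N (i ↑ˡ n)) (F (ℓ₂ j) (ℓ₁ i)) ⟩
      (N (m ↑ʳ j) ∧ N (i ↑ˡ n)) ∧ not (F (ℓ₂ j) (ℓ₁ i))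
        ≡⟨ cong₂ (λ c p → c ∧ not p) (∧-comm (N (m ↑ʳ j)) (N (i ↑ˡ n))) (F-sym (ℓ₂ j) (ℓ₁ i)) ⟩
      crossEdges N F ℓ₁ ℓ₂ i j ∎

  cwAdj-cwComplementOn : ∀ {n} (e : CWExpr k n) N F → (∀ p q → F p q ≡ F q p) →
    SameEdges (cwAdj (cwComplementOn e N F)) (pendingComplement N F e)
  cwAdj-cwComplementOn (vtx a) N F F-sym {zero} {zero} 0≢0 = contradiction refl 0≢0
  cwAdj-cwComplementOn (_⊕_ {m} {n} e₁ e₂) N F F-sym {u} {v} u≢v = begin
    cwAdj (merge F E₁ E₂) u v
      ≡⟨ cwAdj-merge F N (cwLab e₁) (cwLab e₂)
           (cwLab-cwComplementOn e₁ N₁ F) (cwLab-cwComplementOn e₂ N₂ F) u v ⟩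
    union (cwAdj E₁) (cwAdj E₂) (crossEdges N F (cwLab e₁) (cwLab e₂)) u v
      ≡⟨ union-cong (cwAdj-cwComplementOn e₁ N₁ F F-sym) (cwAdj-cwComplementOn e₂ N₂ F F-sym)
                    (λ _ _ → refl) u≢v ⟩
    union (pendingComplement N₁ F e₁) (pendingComplement N₂ F e₂) (crossEdges N F (cwLab e₁) (cwLab e₂)) u v
      ≡⟨ pendingComplement-⊕ e₁ e₂ N F F-sym u v ⟨
    pendingComplement N F (e₁ ⊕ e₂) u v ∎
    where
    N₁ : Fin m → Bool
    N₁ = N ∘ (_↑ˡ n)
    N₂ : Fin n → Bool
    N₂ = N ∘ (m ↑ʳ_)
    E₁ : CWExpr (3 * k) m
    E₁ = cwComplementOn e₁ N₁ F
    E₂ : CWExpr (3 * k) n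
    E₂ = cwComplementOn e₂ N₂ F
  cwAdj-cwComplementOn (ρ a b _ e) N F F-sym {u} {v} u≢v = trans
    (cwAdj-relabel (renameBase a b) (renameBase-idem a b) (cwComplementOn e N (pending-ρ a b F)) u v)
    (cwAdj-cwComplementOn e N (pending-ρ a b F) (λ p q → F-sym (rename a b p) (rename a b q)) u≢v)
  cwAdj-cwComplementOn {n} (η a b a≢b e) N F F-sym {u} {v} u≢v = begin
    cwAdj (addEdges P P-irrefl E) u v
      ≡⟨ cwAdj-addEdges P P-irrefl E u v ⟩
    cwAdj E u v ∨ P (cwLab E u) (cwLab E v) ∨ P (cwLab E v) (cwLab E u)
      ≡⟨ cong₂ _∨_ (cwAdj-cwComplementOn e N F′ F′-sym u≢v) (cong₂ _∨_ (P-at u v) (P-at v u)) ⟩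
    pendingComplement N F′ e u v ∨ (not (N u ∧ N v) ∧ ((ℓ u == a) ∧ (ℓ v == b)))
                                 ∨ (not (N v ∧ N u) ∧ ((ℓ v == a) ∧ (ℓ u == b)))
      ≡⟨ expectedEdge-η (N u) (N v) (cwAdj e u v) (F (ℓ u) (ℓ v))
                        (ℓ u == a) (ℓ v == b) (ℓ u == b) (ℓ v == a) ⟩
    pendingComplement N F (η a b a≢b e) u v ∎
    where
    P : Label → Label → Bool
    P = η-pairs a b
    P-irrefl : ∀ i → P i i ≡ false
    P-irrefl = η-pairs-irrefl a≢b
    ℓ : Fin n → Fin k
    ℓ = cwLab e
    F′ : Fin k → Fin k → Bool
    F′ = pending-η a b F
    F′-sym : ∀ p q → F′ p q ≡ F′ q p
    F′-sym p q = cong₂ _∨_ (linked-sym a b p q) (F-sym p q)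
    E : CWExpr (3 * k) n
    E = cwComplementOn e N F′
    P-at : ∀ w w′ → P (cwLab E w) (cwLab E w′) ≡ not (N w ∧ N w′) ∧ ((ℓ w == a) ∧ (ℓ w′ == b))
    P-at w w′ = trans (cong₂ P (cwLab-cwComplementOn e N F′ w) (cwLab-cwComplementOn e N F′ w′))
                      (η-pairs-withMark a b (N w) (ℓ w) (N w′) (ℓ w′))

LC-InCW : ∀ {k n} {A : Adj n} (x : Fin n) → InCW k A → InCW (3 * k) (LC A x)
LC-InCW {k} {n} x (e , f , A≅e) = cwComplementOn e N noPending , IsoTo-LC {B = cwAdj e} x f A≅e
  (cwAdj-irreflexive e) (cwAdj-irreflexive (cwComplementOn e N noPending)) sameEdges
  where
  N : Fin n → Bool
  N = cwAdj e (to f x)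
  noPending : Fin k → Fin k → Bool
  noPending _ _ = false
  sameEdges : SameEdges (cwAdj (cwComplementOn e N noPending)) (complementOn N (cwAdj e))
  sameEdges {u} {v} u≢v = trans (cwAdj-cwComplementOn e N noPending (λ _ _ → refl) u≢v)
                                (expectedEdge-nothingPending (N u ∧ N v) (cwAdj e u v))

theorem7 : ∀ {n} (A : Adj n) → IsSimple A → (x : Fin n) →
    ∀ (a a' c c' : ℕ) →
    IsNLCW A a → IsNLCW (LC A x) a' →
    IsCW A c → IsCW (LC A x) c' →
    (a ≤ 2 * a' × a' ≤ 2 * a) × (c ≤ 3 * c' × c' ≤ 3 * c)
theorem7 A simple x a a' c c' (A∈a , a-least) (LA∈a' , a'-least) (A∈c , c-least) (LA∈c' , c'-least) =
  ( a-least (2 * a') (InNLC-resp LC-LC (LC-InNLC x LA∈a'))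
  , a'-least (2 * a) (LC-InNLC x A∈a) )
  , ( c-least (3 * c') (InCW-resp LC-LC (LC-InCW x LA∈c'))
  , c'-least (3 * c) (LC-InCW x A∈c) )
  where
  LC-LC : ∀ u v → LC (LC A x) x u v ≡ A u v
  LC-LC = LC-involutive A x (IsSimple.irrefl simple x)
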